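{- Let $c\in\omega^\omega$. Two vertices $(n_0,k_0,x_0),(n_1,k_1,x_1)\in X_c$ are in the same connected component of $\mathbb L_c$ if and only if there are $t_0,t_1\in2^{<\omega}$ and $x\in2^\omega$ such that $|t_0|-|t_1|=n_1-n_0$ and $x_i=t_i{}^\frown x$ for $i<2$.
   Context: Finite paths: fix distinct symbols $p_0,p_1,\dots$; vertices are finite sequences $(p_k)^\frown t$, $t$ a finite binary string. For $c\in\omega^\omega$: $L^c_0$ has the single vertex $(p_0)$, no edges, endpoints $e^0_0=e^0_1=(p_0)$. Given $L^c_n$, $L^c_{n+1}$ has vertices $v^\frown(i)$ ($v\in V(L^c_n)$, $i<2$) and new vertices $(p_0),\dots,(p_{c(n)})$; edges $\{v^\frown(i),w^\frown(i)\}$ for each edge $\{v,w\}$ of $L^c_n$, $i<2$, plus the edges of the path $(e^n_1{}^\frown(0),(p_0),\dots,(p_{c(n)}),e^n_1{}^\frown(1))$; endpoints $e^{n+1}_i=e^n_0{}^\frown(i)$. The graph $\mathbb L_c$: $X_c$ is the set of $(m,k,x)\in\mathbb N\times\mathbb N\times2^{\mathbb N}$ with either $m=k=0$, or $m\geq1$ and $k\leq c(m-1)$. For $n\geq m$, $\pi_n(m,k,x)=(p_k)^\frown(x\restriction(n-m))\in V(L^c_n)$. Vertices $(n_0,k_0,x_0),(n_1,k_1,x_1)$ are adjacent in $\mathbb L_c$ iff $\pi_n(n_0,k_0,x_0),\pi_n(n_1,k_1,x_1)$ are adjacent in $L^c_n$ for all $n\geq\max\{n_0,n_1\}$. -}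

module Defs where

open import Data.Nat using (ℕ; zero; suc; _≤_; _<_; _∸_; _⊔_)
open import Data.Bool using (Bool; true; false)
open import Data.List using (List; []; _∷_; _++_; [_]; length)
open import Data.Product using (Σ; _×_; _,_; proj₁; proj₂)
open import Data.Sum using (_⊎_)
open import Relation.Binary.PropositionalEquality using (_≡_)
open import Relation.Binary.Construct.Closure.ReflexiveTransitive using (Star)

Baire : Set
Baire = ℕ → ℕ

Cantor : Set
Cantor = ℕ → Bool

-- A vertex (p_k)⁀t of a finite path is represented as the pair (k , t).
Vtx : Set
Vtx = ℕ × List Bool

app : Vtx → Bool → Vtx
app (k , t) i = (k , t ++ [ i ])

e₀ : ℕ → Vtx
e₀ zero = (0 , [])
e₀ (suc n) = app (e₀ n) false

e₁ : ℕ → Vtx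
e₁ zero = (0 , [])
e₁ (suc n) = app (e₀ n) true

-- Edge c n v w : the (unordered) edge {v , w} of L^c_n, listed in one orientation
data Edge (c : Baire) : ℕ → Vtx → Vtx → Set where
  lift  : ∀ {n v w} → Edge c n v w → (i : Bool) → Edge c (suc n) (app v i) (app w i)
  pathL : ∀ {n} → Edge c (suc n) (app (e₁ n) false) (0 , [])
  pathM : ∀ {n j} → j < c n → Edge c (suc n) (j , []) (suc j , [])
  pathR : ∀ {n} → Edge c (suc n) (c n , []) (app (e₁ n) true)

AdjL : Baire → ℕ → Vtx → Vtx → Set
AdjL c n v w = Edge c n v w ⊎ Edge c n w v

restrict : Cantor → ℕ → List Bool
restrict x zero = []
restrict x (suc n) = x 0 ∷ restrict (λ j → x (suc j)) n

prepend : List Bool → Cantor → Cantor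
prepend [] x = x
prepend (b ∷ t) x zero = b
prepend (b ∷ t) x (suc j) = prepend t x j

InX : Baire → ℕ → ℕ → Set
InX c m k = (m ≡ 0 × k ≡ 0) ⊎ (1 ≤ m × k ≤ c (m ∸ 1))

X : Baire → Set
X c = Σ (ℕ × ℕ × Cantor) λ { (m , k , x) → InX c m k }

-- π_n(m,k,x) = (p_k)⁀(x ↾ (n - m))   (used for n ≥ m)
π : ℕ → ℕ × ℕ × Cantor → Vtx
π n (m , k , x) = (k , restrict x (n ∸ m))

Adj𝕃 : (c : Baire) → X c → X c → Set
Adj𝕃 c ((n₀ , k₀ , x₀) , _) ((n₁ , k₁ , x₁) , _) =
  ∀ n → n₀ ⊔ n₁ ≤ n → AdjL c n (π n (n₀ , k₀ , x₀)) (π n (n₁ , k₁ , x₁))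

SameComponent : (c : Baire) → X c → X c → Set
SameComponent c = Star (Adj𝕃 c)

{-# OPTIONS --safe #-}
-- A point (m , k , x) of X_c with x = t ⁀ y and m + |t| = N sits above the vertex (p_k)⁀t of
-- L^c_N.  Each edge of L^c_N lifts to an edge of 𝕃_c between the points above its endpoints
-- that share the tail y, and L^c_N is connected; hence points with tails t₀ ⁀ y and t₁ ⁀ y at
-- matching levels lie in one component.  Conversely, an edge of L^c_n between two vertices with
-- nonempty strings is a lift, so it preserves the last bit: two adjacent points of 𝕃_c have
-- sequences that agree beyond the stage at which both exist.  Along a path these lags add up,
-- so points in one component have a common tail with lag equal to the difference of levels.
module Submission where

open import Defs
open import Data.Nat using (ℕ)
open import Data.Bool using (Bool)
open import Data.List using (List; length)
open import Data.Integer using (_⊖_)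
open import Data.Product using (Σ; _×_; _,_)
open import Relation.Binary.PropositionalEquality using (_≡_)
open import Function.Bundles using (_⇔_)

open import Data.Nat using (zero; suc; _+_; _∸_; _≤_; _⊔_; z≤n; s≤s; s≤s⁻¹)
open import Data.Nat.Properties
  using ( +-identityʳ; +-suc; +-comm; +-assoc; suc-injective; m+n∸m≡n; m+n∸n≡m; m∸n+n≡m
        ; +-∸-comm; m≤m+n; m≤n+m; m≤m⊔n; m≤n⊔m; ⊔-comm; ≤-refl; ≤-reflexive; ≤-trans; <⇒≤
        ; m≤n⇒∃[o]m+o≡n; +-commutativeSemigroup)
open import Algebra.Properties.CommutativeSemigroup +-commutativeSemigroup using (x∙yz≈y∙xz)
import Data.Integer as ℤ
import Data.Integer.Properties as ℤ
open import Data.Integer.Tactic.RingSolver using (solve-∀)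
open import Data.Bool using (true; false)
open import Data.List using ([]; _∷_; _++_; [_]; _∷ʳ_; initLast; _∷ʳ′_)
open import Data.List.Properties using (length-++; ++-assoc; ++-identityʳ; ∷ʳ-injectiveʳ)
open import Data.Product using (proj₁; proj₂; map₁; map₂)
open import Data.Sum using (inj₁; inj₂; swap) renaming (map to ⊎-map)
open import Data.Empty using (⊥-elim)
open import Relation.Binary.PropositionalEquality
  using (_≢_; refl; sym; trans; cong; cong₂; subst; subst₂; module ≡-Reasoning)
open import Relation.Binary.Construct.Closure.ReflexiveTransitive
  using (Star; ε; _◅_; _◅◅_; gmap; fold; reverse)
open import Function.Base using (_∘_)
open import Function.Bundles using (mk⇔; Equivalence)

m+n≡o⇒o+p∸m≡n+p : ∀ {m n o} → m + n ≡ o → ∀ p → o + p ∸ m ≡ n + p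
m+n≡o⇒o+p∸m≡n+p {m} {n} refl p = trans (cong (_∸ m) (+-assoc m n p)) (m+n∸m≡n m (n + p))

m+0≡n⇒n≤m : ∀ {m n} → m + 0 ≡ n → n ≤ m
m+0≡n⇒n≤m {m} eq = ≤-reflexive (trans (sym eq) (+-identityʳ m))

⊖≡⊖⇔+≡+ : ∀ a b c d → a ⊖ b ≡ c ⊖ d ⇔ a + d ≡ c + b
⊖≡⊖⇔+≡+ a b c d = mk⇔ to from
  where
  open ≡-Reasoning
  from : a + d ≡ c + b → a ⊖ b ≡ c ⊖ d
  from e = begin
    a ⊖ b             ≡⟨ ℤ.+-cancelˡ-⊖ d a b ⟨
    (d + a) ⊖ (d + b) ≡⟨ cong₂ _⊖_ (trans (+-comm d a) (trans e (+-comm c b))) (+-comm d b) ⟩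
    (b + c) ⊖ (b + d) ≡⟨ ℤ.+-cancelˡ-⊖ b c d ⟩
    c ⊖ d             ∎
  split : ∀ i j k → i ℤ.+ k ≡ (i ℤ.- j) ℤ.+ (j ℤ.+ k)
  split = solve-∀
  differences : a ⊖ b ≡ c ⊖ d → ℤ.+ a ℤ.- ℤ.+ b ≡ ℤ.+ c ℤ.- ℤ.+ d
  differences e = trans (ℤ.[+m]-[+n]≡m⊖n a b) (trans e (sym (ℤ.[+m]-[+n]≡m⊖n c d)))
  to : a ⊖ b ≡ c ⊖ d → a + d ≡ c + b
  to e = ℤ.+-injective (begin
    ℤ.+ (a + d)                             ≡⟨ ℤ.pos-+ a d ⟩
    ℤ.+ a ℤ.+ ℤ.+ d                         ≡⟨ split (ℤ.+ a) (ℤ.+ b) (ℤ.+ d) ⟩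
    (ℤ.+ a ℤ.- ℤ.+ b) ℤ.+ (ℤ.+ b ℤ.+ ℤ.+ d) ≡⟨ cong (ℤ._+ (ℤ.+ b ℤ.+ ℤ.+ d)) (differences e) ⟩
    (ℤ.+ c ℤ.- ℤ.+ d) ℤ.+ (ℤ.+ b ℤ.+ ℤ.+ d) ≡⟨ cong (λ z → (ℤ.+ c ℤ.- ℤ.+ d) ℤ.+ z)
                                                      (ℤ.+-comm (ℤ.+ b) (ℤ.+ d)) ⟩
    (ℤ.+ c ℤ.- ℤ.+ d) ℤ.+ (ℤ.+ d ℤ.+ ℤ.+ b) ≡⟨ split (ℤ.+ c) (ℤ.+ d) (ℤ.+ b) ⟨
    ℤ.+ c ℤ.+ ℤ.+ b                         ≡⟨ ℤ.pos-+ c b ⟨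
    ℤ.+ (c + b)                             ∎)

_≐_ : Cantor → Cantor → Set
x ≐ y = ∀ j → x j ≡ y j

shift : ℕ → Cantor → Cantor
shift p x j = x (p + j)

[]≢∷ʳ : ∀ (s : List Bool) {b} → [] ≢ s ∷ʳ b
[]≢∷ʳ []      ()
[]≢∷ʳ (_ ∷ _) ()

length-∷ʳ : ∀ (t : List Bool) b → length (t ∷ʳ b) ≡ suc (length t)
length-∷ʳ t b = trans (length-++ t) (+-comm (length t) 1)

prepend-++ : ∀ t u y → prepend (t ++ u) y ≐ prepend t (prepend u y)
prepend-++ []      u y j       = refl
prepend-++ (b ∷ t) u y zero    = refl
prepend-++ (b ∷ t) u y (suc j) = prepend-++ t u y j

restrict-cong : ∀ {x x'} → x ≐ x' → ∀ n → restrict x n ≡ restrict x' n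
restrict-cong x≐x' zero    = refl
restrict-cong x≐x' (suc n) = cong₂ _∷_ (x≐x' 0) (restrict-cong (λ j → x≐x' (suc j)) n)

length-restrict : ∀ x n → length (restrict x n) ≡ n
length-restrict x zero    = refl
length-restrict x (suc n) = cong suc (length-restrict (shift 1 x) n)

restrict-suc : ∀ x n → restrict x (suc n) ≡ restrict x n ∷ʳ x n
restrict-suc x zero    = refl
restrict-suc x (suc n) = cong (x 0 ∷_) (restrict-suc (shift 1 x) n)

restrict-prepend : ∀ t y d → restrict (prepend t y) (length t + d) ≡ t ++ restrict y d
restrict-prepend []      y d = refl
restrict-prepend (b ∷ t) y d = cong (b ∷_) (restrict-prepend t y d)

restrict-prepend-∸ : ∀ t m {Z} y → m + length t ≡ Z → ∀ d →
                     restrict (prepend t y) (Z + d ∸ m) ≡ t ++ restrict y d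
restrict-prepend-∸ t m y eq d =
  trans (cong (restrict (prepend t y)) (m+n≡o⇒o+p∸m≡n+p eq d)) (restrict-prepend t y d)

prepend-restrict : ∀ p x {y} → shift p x ≐ y → x ≐ prepend (restrict x p) y
prepend-restrict zero    x eq j       = eq j
prepend-restrict (suc p) x eq zero    = refl
prepend-restrict (suc p) x eq (suc j) = prepend-restrict p (shift 1 x) eq j

⌊_⌋ : ℕ × ℕ × Cantor → ℕ × Cantor
⌊ m , _ , x ⌋ = m , x

data _∼_ : ℕ × Cantor → ℕ × Cantor → Set where
  lagged : ∀ {m m' x x'} p q → p + m ≡ q + m' → shift p x ≐ shift q x' → (m , x) ∼ (m' , x')

∼-refl : ∀ {a} → a ∼ a
∼-refl = lagged 0 0 refl (λ _ → refl)

∼-trans : ∀ {a b d} → a ∼ b → b ∼ d → a ∼ d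
∼-trans {m , x} {m' , x'} {m'' , x''} (lagged p q e x≐x') (lagged p' q' e' x'≐x'') =
  lagged (p + p') (q' + q) levels agree
  where
  open ≡-Reasoning
  levels : p + p' + m ≡ q' + q + m''
  levels = begin
    p + p' + m      ≡⟨ cong (_+ m) (+-comm p p') ⟩
    p' + p + m      ≡⟨ +-assoc p' p m ⟩
    p' + (p + m)    ≡⟨ cong (p' +_) e ⟩
    p' + (q + m')   ≡⟨ x∙yz≈y∙xz p' q m' ⟩
    q + (p' + m')   ≡⟨ cong (q +_) e' ⟩
    q + (q' + m'')  ≡⟨ x∙yz≈y∙xz q q' m'' ⟩
    q' + (q + m'')  ≡⟨ +-assoc q' q m'' ⟨
    q' + q + m''    ∎
  agree : shift (p + p') x ≐ shift (q' + q) x''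
  agree j = begin
    x (p + p' + j)     ≡⟨ cong x (+-assoc p p' j) ⟩
    x (p + (p' + j))   ≡⟨ x≐x' (p' + j) ⟩
    x' (q + (p' + j))  ≡⟨ cong x' (x∙yz≈y∙xz q p' j) ⟩
    x' (p' + (q + j))  ≡⟨ x'≐x'' (q + j) ⟩
    x'' (q' + (q + j)) ≡⟨ cong x'' (+-assoc q' q j) ⟨
    x'' (q' + q + j)   ∎

CommonTail : ℕ × Cantor → ℕ × Cantor → Set
CommonTail (n₀ , x₀) (n₁ , x₁) =
  Σ (List Bool) λ t₀ → Σ (List Bool) λ t₁ → Σ Cantor λ x →
    (length t₀ ⊖ length t₁ ≡ n₁ ⊖ n₀) × x₀ ≐ prepend t₀ x × x₁ ≐ prepend t₁ x

∼⇒CommonTail : ∀ {a b} → a ∼ b → CommonTail a b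
∼⇒CommonTail {n₀ , x₀} {n₁ , x₁} (lagged p q p+n₀≡q+n₁ agree) =
  restrict x₀ p , restrict x₁ q , shift p x₀ ,
  subst₂ (λ l l' → l ⊖ l' ≡ n₁ ⊖ n₀) (sym (length-restrict x₀ p)) (sym (length-restrict x₁ q))
         (Equivalence.from (⊖≡⊖⇔+≡+ p q n₁ n₀) (trans p+n₀≡q+n₁ (+-comm q n₁))) ,
  prepend-restrict p x₀ (λ _ → refl) , prepend-restrict q x₁ (λ j → sym (agree j))

-- The finite paths L^c_n

module _ {c : Baire} where

  -- (p_k)⁀t is a vertex of L^c_N exactly when p_k is added at stage N ∸ |t|.
  data IsVertex (N : ℕ) : Vtx → Set where
    vertex : ∀ {k t} → length t ≤ N → InX c (N ∸ length t) k → IsVertex N (k , t)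

  InX-suc : ∀ {n k} → InX c (suc n) k → k ≤ c n
  InX-suc (inj₁ (() , _))
  InX-suc (inj₂ (_ , k≤cn)) = k≤cn

  isVertex-new : ∀ {n k} → k ≤ c n → IsVertex (suc n) (k , [])
  isVertex-new k≤cn = vertex z≤n (inj₂ (s≤s z≤n , k≤cn))

  isVertex-app : ∀ {n} v b → IsVertex n v → IsVertex (suc n) (app v b)
  isVertex-app (k , t) b (vertex |t|≤n h) = vertex-length (length-∷ʳ t b) (s≤s |t|≤n) h
    where
    vertex-length : ∀ {N k t l} → length t ≡ l → l ≤ N → InX c (N ∸ l) k → IsVertex N (k , t)
    vertex-length refl = vertex

  isVertex-app⁻¹ : ∀ {n} v b → IsVertex (suc n) (app v b) → IsVertex n v
  isVertex-app⁻¹ (k , t) b (vertex |t∷ʳb|≤1+n h) rewrite length-∷ʳ t b =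
    vertex (s≤s⁻¹ |t∷ʳb|≤1+n) h

  isVertex-e₀ : ∀ N → IsVertex N (e₀ N)
  isVertex-e₀ zero    = vertex z≤n (inj₁ (refl , refl))
  isVertex-e₀ (suc N) = isVertex-app (e₀ N) false (isVertex-e₀ N)

  isVertex-e₁ : ∀ N → IsVertex N (e₁ N)
  isVertex-e₁ zero    = isVertex-e₀ zero
  isVertex-e₁ (suc N) = isVertex-app (e₀ N) true (isVertex-e₀ N)

  Edge-isVertex : ∀ {N v w} → Edge c N v w → IsVertex N v × IsVertex N w
  Edge-isVertex (lift {v = v} {w} e i) =
    map₁ (isVertex-app v i) (map₂ (isVertex-app w i) (Edge-isVertex e))
  Edge-isVertex (pathL {n})  = isVertex-app (e₁ n) false (isVertex-e₁ n) , isVertex-new z≤n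
  Edge-isVertex (pathM j<cn) = isVertex-new (<⇒≤ j<cn) , isVertex-new j<cn
  Edge-isVertex (pathR {n})  = isVertex-new ≤-refl , isVertex-app (e₁ n) true (isVertex-e₁ n)

  AdjL-isVertexʳ : ∀ {N v w} → AdjL c N v w → IsVertex N w
  AdjL-isVertexʳ (inj₁ e) = proj₂ (Edge-isVertex e)
  AdjL-isVertexʳ (inj₂ e) = proj₁ (Edge-isVertex e)

  app⋆ : ∀ {n v w} b → Star (AdjL c n) v w → Star (AdjL c (suc n)) (app v b) (app w b)
  app⋆ b = gmap (λ v → app v b) (⊎-map (λ e → lift e b) (λ e → lift e b))

  new⇝p₀ : ∀ {n} k → k ≤ c n → Star (AdjL c (suc n)) (k , []) (0 , [])
  new⇝p₀ zero    _    = ε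
  new⇝p₀ (suc k) k<cn = inj₂ (pathM k<cn) ◅ new⇝p₀ k (<⇒≤ k<cn)

  module _ {n} (e₁⇝e₀ : Star (AdjL c n) (e₁ n) (e₀ n)) where

    new⇝e₀ : ∀ {k} → k ≤ c n → Star (AdjL c (suc n)) (k , []) (e₀ (suc n))
    new⇝e₀ {k} k≤cn = new⇝p₀ k k≤cn ◅◅ inj₂ pathL ◅ app⋆ false e₁⇝e₀

    copy⇝e₀ : ∀ b → Star (AdjL c (suc n)) (app (e₀ n) b) (e₀ (suc n))
    copy⇝e₀ false = ε
    copy⇝e₀ true  = app⋆ true (reverse swap e₁⇝e₀) ◅◅ inj₂ pathR ◅ new⇝e₀ ≤-refl

  connected : ∀ N {v} → IsVertex N v → Star (AdjL c N) v (e₀ N)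
  connected zero    (vertex {t = []}    _  (inj₁ (_ , refl))) = ε
  connected zero    (vertex {t = []}    _  (inj₂ (() , _)))
  connected zero    (vertex {t = _ ∷ _} () _)
  connected (suc n) v∈L@(vertex {k} {t} _ h) with initLast t
  ... | []      = new⇝e₀ (connected n (isVertex-e₁ n)) (InX-suc h)
  ... | s ∷ʳ′ b = app⋆ b (connected n (isVertex-app⁻¹ (k , s) b v∈L))
                  ◅◅ copy⇝e₀ (connected n (isVertex-e₁ n)) b

  Edge-++ : ∀ s {n k k' t t'} → Edge c n (k , t) (k' , t') →
            Edge c (n + length s) (k , t ++ s) (k' , t' ++ s)
  Edge-++ [] {n} {t = t} {t'} e
    rewrite +-identityʳ n | ++-identityʳ t | ++-identityʳ t' = e
  Edge-++ (b ∷ s) {n} {t = t} {t'} e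
    rewrite +-suc n (length s) | sym (++-assoc t [ b ] s) | sym (++-assoc t' [ b ] s) =
    Edge-++ s (lift e b)

  Edge-last : ∀ {n v w s s' b b'} → Edge c n v w → proj₂ v ≡ s ∷ʳ b → proj₂ w ≡ s' ∷ʳ b' → b ≡ b'
  Edge-last {s = s} {s'} (lift {v = _ , t} {_ , t'} e i) v≡s∷ʳb w≡s'∷ʳb' =
    trans (sym (∷ʳ-injectiveʳ t s v≡s∷ʳb)) (∷ʳ-injectiveʳ t' s' w≡s'∷ʳb')
  Edge-last {s' = s'} pathL     _       []≡s'∷ʳb' = ⊥-elim ([]≢∷ʳ s' []≡s'∷ʳb')
  Edge-last {s = s}   (pathM _) []≡s∷ʳb _         = ⊥-elim ([]≢∷ʳ s []≡s∷ʳb)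
  Edge-last {s = s}   pathR     []≡s∷ʳb _         = ⊥-elim ([]≢∷ʳ s []≡s∷ʳb)

  AdjL-last : ∀ {n k k' s s' b b'} → AdjL c n (k , s ∷ʳ b) (k' , s' ∷ʳ b') → b ≡ b'
  AdjL-last (inj₁ e) = Edge-last e refl refl
  AdjL-last (inj₂ e) = sym (Edge-last e refl refl)

  -- The graph 𝕃_c

  -- Adj𝕃 c (a , h) (b , h') unfolds to a — b: adjacency does not look at the proofs of membership.
  _—_ : ℕ × ℕ × Cantor → ℕ × ℕ × Cantor → Set
  a — b = ∀ n → proj₁ a ⊔ proj₁ b ≤ n → AdjL c n (π n a) (π n b)

  —-sym : ∀ a b → a — b → b — a
  —-sym (m , _) (m' , _) adj n m'⊔m≤n = swap (adj n (subst (_≤ n) (⊔-comm m' m) m'⊔m≤n))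

  —-respˡ : ∀ m k b {x x'} → x ≐ x' → (m , k , x) — b → (m , k , x') — b
  —-respˡ m k b x≐x' adj n le =
    subst (λ s → AdjL c n (k , s) (π n b)) (restrict-cong x≐x' (n ∸ m)) (adj n le)

  Edge-restrict : ∀ {Z k k' t t' m m' n x x'} y → Edge c Z (k , t) (k' , t') →
                  m + length t ≡ Z → m' + length t' ≡ Z → x ≐ prepend t y → x' ≐ prepend t' y →
                  Z ≤ n → Edge c n (k , restrict x (n ∸ m)) (k' , restrict x' (n ∸ m'))
  Edge-restrict {Z} {k} {k'} {t} {t'} {m} {m'} y e eq eq' x≐ x'≐ Z≤n with m≤n⇒∃[o]m+o≡n Z≤n
  ... | d , refl =
    subst₂ (λ s s' → Edge c (Z + d) (k , s) (k' , s'))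
           (sym (trans (restrict-cong x≐ (Z + d ∸ m)) (restrict-prepend-∸ t m y eq d)))
           (sym (trans (restrict-cong x'≐ (Z + d ∸ m')) (restrict-prepend-∸ t' m' y eq' d)))
           (subst (λ l → Edge c (Z + l) (k , t ++ restrict y d) (k' , t' ++ restrict y d))
                  (length-restrict y d) (Edge-++ (restrict y d) e))

  Edge→—-above : ∀ {Z k k' t t' m m' x x' y} → Edge c Z (k , t) (k' , t') →
                 m + length t ≡ Z → m' + length t' ≡ Z → Z ≤ m ⊔ m' →
                 x ≐ prepend t y → x' ≐ prepend t' y → (m , k , x) — (m' , k' , x')
  Edge→—-above {y = y} e eq eq' Z≤m⊔m' x≐ x'≐ n le =
    inj₁ (Edge-restrict y e eq eq' x≐ x'≐ (≤-trans Z≤m⊔m' le))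

  -- A path edge of L^c_Z has an endpoint added at stage Z, so Z ≤ m ⊔ m' and Edge-restrict applies;
  -- a lifted edge comes from stage Z ∸ 1, with the last bit of the strings moved into the tail.
  Edge→— : ∀ {Z k k' t t'} m m' {x x'} y → Edge c Z (k , t) (k' , t') →
           m + length t ≡ Z → m' + length t' ≡ Z → x ≐ prepend t y → x' ≐ prepend t' y →
           (m , k , x) — (m' , k' , x')
  Edge→— m m' y (lift {v = _ , t} {_ , t'} e i) eq eq' x≐ x'≐ =
    Edge→— m m' (prepend [ i ] y) e (level-init m t eq) (level-init m' t' eq')
           (λ j → trans (x≐ j) (prepend-++ t [ i ] y j))
           (λ j → trans (x'≐ j) (prepend-++ t' [ i ] y j))
    where
    level-init : ∀ {n} m t → m + length (t ∷ʳ i) ≡ suc n → m + length t ≡ n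
    level-init m t eq =
      suc-injective (trans (sym (+-suc m (length t))) (trans (cong (m +_) (sym (length-∷ʳ t i))) eq))
  Edge→— m m' y e@pathL     eq eq' = Edge→—-above e eq eq' (≤-trans (m+0≡n⇒n≤m eq') (m≤n⊔m m m'))
  Edge→— m m' y e@(pathM _) eq eq' = Edge→—-above e eq eq' (≤-trans (m+0≡n⇒n≤m eq) (m≤m⊔n m m'))
  Edge→— m m' y e@pathR     eq eq' = Edge→—-above e eq eq' (≤-trans (m+0≡n⇒n≤m eq) (m≤m⊔n m m'))

  embed : ∀ {N v} → IsVertex N v → Cantor → X c
  embed {N} (vertex {k} {t} _ h) y = (N ∸ length t , k , prepend t y) , h

  AdjL→Adj𝕃 : ∀ {N v w} → AdjL c N v w → (v∈L : IsVertex N v) (w∈L : IsVertex N w) →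
              ∀ y → Adj𝕃 c (embed v∈L y) (embed w∈L y)
  AdjL→Adj𝕃 {N} (inj₁ e) (vertex {t = t} |t|≤N _) (vertex {t = t'} |t'|≤N _) y =
    Edge→— (N ∸ length t) (N ∸ length t') y e (m∸n+n≡m |t|≤N) (m∸n+n≡m |t'|≤N)
           (λ _ → refl) (λ _ → refl)
  AdjL→Adj𝕃 {N} (inj₂ e) (vertex {k} {t} |t|≤N _) (vertex {k'} {t'} |t'|≤N _) y =
    —-sym (N ∸ length t' , k' , prepend t' y) (N ∸ length t , k , prepend t y)
      (Edge→— (N ∸ length t') (N ∸ length t) y e (m∸n+n≡m |t'|≤N) (m∸n+n≡m |t|≤N)
              (λ _ → refl) (λ _ → refl))

  neighbour : (a : X c) → Σ (X c) (Adj𝕃 c a)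
  neighbour ((zero , _ , x) , inj₁ (_ , refl)) =
    map₂ (—-respˡ 0 0 _ first-bit) (stage-one (x 0) (shift 1 x))
    where
    first-bit : prepend [ x 0 ] (shift 1 x) ≐ x
    first-bit zero    = refl
    first-bit (suc j) = refl
    v∈L : ∀ {b} → IsVertex 1 (0 , [ b ])
    v∈L = vertex (s≤s z≤n) (inj₁ (refl , refl))
    stage-one : ∀ b y → Σ (X c) (Adj𝕃 c ((0 , 0 , prepend [ b ] y) , inj₁ (refl , refl)))
    stage-one false y = embed (isVertex-new z≤n) y ,
                        AdjL→Adj𝕃 (inj₁ (pathL {n = 0})) v∈L (isVertex-new z≤n) y
    stage-one true  y = embed (isVertex-new ≤-refl) y ,
                        AdjL→Adj𝕃 (inj₂ (pathR {n = 0})) v∈L (isVertex-new ≤-refl) y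
  neighbour ((zero , _ , _) , inj₂ (() , _))
  neighbour ((suc n , zero , x) , _) =
    embed w∈L x , AdjL→Adj𝕃 (inj₂ pathL) (isVertex-new z≤n) w∈L x
    where
    w∈L : IsVertex (suc n) (app (e₁ n) false)
    w∈L = isVertex-app (e₁ n) false (isVertex-e₁ n)
  neighbour ((suc n , suc j , x) , h) =
    embed w∈L x , AdjL→Adj𝕃 (inj₂ (pathM (InX-suc h))) (isVertex-new (InX-suc h)) w∈L x
    where
    w∈L : IsVertex (suc n) (j , [])
    w∈L = isVertex-new (<⇒≤ (InX-suc h))

  -- Without function extensionality, pointwise equal sequences (or different membership proofs)
  -- give distinct points of X_c; they are joined through a common neighbour.
  SameComponent-≈ : ∀ {m m' k x x'} {h : InX c m k} {h' : InX c m' k} → m ≡ m' → x ≐ x' →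
                    SameComponent c ((m , k , x) , h) ((m' , k , x') , h')
  SameComponent-≈ {m} {k = k} {x} {x'} {h} refl x≐x' with neighbour ((m , k , x) , h)
  ... | b , adj =
    _◅_ {j = b} adj (—-sym (m , k , x') (proj₁ b) (—-respˡ m k (proj₁ b) x≐x' adj) ◅ ε)

  embed⋆ : ∀ {N v w} → Star (AdjL c N) v w → (v∈L : IsVertex N v) (w∈L : IsVertex N w) →
           ∀ y → SameComponent c (embed v∈L y) (embed w∈L y)
  embed⋆ ε       (vertex _ _) (vertex _ _) y = SameComponent-≈ refl (λ _ → refl)
  embed⋆ (a ◅ p) v∈L          w∈L          y =
    AdjL→Adj𝕃 a v∈L (AdjL-isVertexʳ a) y ◅ embed⋆ p (AdjL-isVertexʳ a) w∈L y

  SameComponent-hub : ∀ {N m k x} (h : InX c m k) t y → m + length t ≡ N → x ≐ prepend t y →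
                      SameComponent c ((m , k , x) , h) (embed (isVertex-e₀ N) y)
  SameComponent-hub {N} {m} {k} h t y eq x≐ =
    SameComponent-≈ m≡N∸|t| x≐ ◅◅ embed⋆ (connected N v∈L) v∈L (isVertex-e₀ N) y
    where
    m≡N∸|t| : m ≡ N ∸ length t
    m≡N∸|t| = sym (trans (cong (_∸ length t) (sym eq)) (m+n∸n≡m m (length t)))
    v∈L : IsVertex N (k , t)
    v∈L = vertex (subst (length t ≤_) eq (m≤n+m (length t) m)) (subst (λ l → InX c l k) m≡N∸|t| h)

  CommonTail⇒SameComponent : ∀ {n₀ k₀ x₀ n₁ k₁ x₁} (h₀ : InX c n₀ k₀) (h₁ : InX c n₁ k₁) →
                             CommonTail (n₀ , x₀) (n₁ , x₁) →
                             SameComponent c ((n₀ , k₀ , x₀) , h₀) ((n₁ , k₁ , x₁) , h₁)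
  CommonTail⇒SameComponent {n₀} {n₁ = n₁} h₀ h₁ (t₀ , t₁ , x , lengths , x₀≐ , x₁≐) =
    SameComponent-hub h₀ t₀ x refl x₀≐
    ◅◅ reverse (λ {a} {b} → —-sym (proj₁ a) (proj₁ b)) (SameComponent-hub h₁ t₁ x levels x₁≐)
    where
    levels : n₁ + length t₁ ≡ n₀ + length t₀
    levels = sym (trans (+-comm n₀ (length t₀))
                        (Equivalence.to (⊖≡⊖⇔+≡+ (length t₀) (length t₁) n₁ n₀) lengths))

  —⇒∼ : ∀ a b → a — b → ⌊ a ⌋ ∼ ⌊ b ⌋
  —⇒∼ (m , k , x) (m' , k' , x') adj =
    lagged (M ∸ m) (M ∸ m') (trans (m∸n+n≡m (m≤m⊔n m m')) (sym (m∸n+n≡m (m≤n⊔m m m')))) agree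
    where
    M : ℕ
    M = m ⊔ m'
    restrict-last : ∀ z {l} → l ≤ M → ∀ j →
                    restrict z (M + suc j ∸ l) ≡ restrict z (M ∸ l + j) ∷ʳ z (M ∸ l + j)
    restrict-last z {l} l≤M j =
      trans (cong (restrict z) (trans (+-∸-comm (suc j) l≤M) (+-suc (M ∸ l) j)))
            (restrict-suc z (M ∸ l + j))
    agree : shift (M ∸ m) x ≐ shift (M ∸ m') x'
    agree j = AdjL-last (subst₂ (λ s s' → AdjL c (M + suc j) (k , s) (k' , s'))
                                (restrict-last x (m≤m⊔n m m') j) (restrict-last x' (m≤n⊔m m m') j)
                                (adj (M + suc j) (m≤m+n M (suc j))))

  SameComponent⇒∼ : ∀ {n₀ k₀ x₀ n₁ k₁ x₁} {h₀ : InX c n₀ k₀} {h₁ : InX c n₁ k₁} →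
                    SameComponent c ((n₀ , k₀ , x₀) , h₀) ((n₁ , k₁ , x₁) , h₁) →
                    (n₀ , x₀) ∼ (n₁ , x₁)
  SameComponent⇒∼ =
    fold (λ a b → ⌊ proj₁ a ⌋ ∼ ⌊ proj₁ b ⌋)
         (λ {a} {b} adj → ∼-trans (—⇒∼ (proj₁ a) (proj₁ b) adj)) ∼-refl

lemma4p1 : (c : Baire) (n₀ k₀ n₁ k₁ : ℕ) (x₀ x₁ : Cantor)
    (h₀ : InX c n₀ k₀) (h₁ : InX c n₁ k₁) →
    SameComponent c ((n₀ , k₀ , x₀) , h₀) ((n₁ , k₁ , x₁) , h₁)
    ⇔ Σ (List Bool) λ t₀ → Σ (List Bool) λ t₁ → Σ Cantor λ x →
        (length t₀ ⊖ length t₁ ≡ n₁ ⊖ n₀)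
        × (∀ j → x₀ j ≡ prepend t₀ x j)
        × (∀ j → x₁ j ≡ prepend t₁ x j)
lemma4p1 c n₀ k₀ n₁ k₁ x₀ x₁ h₀ h₁ =
  mk⇔ (∼⇒CommonTail ∘ SameComponent⇒∼) (CommonTail⇒SameComponent h₀ h₁)
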